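{- Let $N>0$ be an integer and let $k_N=\dfrac{1}{2^{N+4}}$. If a finite bipartite graph $(X,Y;E)$ has VC-minimal complexity $<N$, then there exist $X'\subseteq X$ and $Y'\subseteq Y$ with $|X'|\geq k_N|X|$ and $|Y'|\geq k_N|Y|$ such that $X'\times Y'\subseteq E$ or $(X'\times Y')\cap E=\emptyset$.
   Context: A finite bipartite graph is a triple $(X,Y;E)$ where $X,Y$ are finite sets with $X\cap Y=\emptyset$ and $E\subseteq X\times Y$. For $a\in X$ and $S\subseteq Y$, write $E(a,S)=\{b\in S:(a,b)\in E\}$. Given a set $U$, a family $\Psi\subseteq\mathcal{P}(U)$ is a directed family if for any $B,B'\in\Psi$ we have $B\subseteq B'$ or $B'\subseteq B$ or $B\cap B'=\emptyset$; elements of $\Psi$ are called $\Psi$-balls. A $\Psi$-Swiss cheese is a set of the form $B\setminus(B_1\cup\dots\cup B_h)$ with $h\ge 0$ and $B,B_1,\dots,B_h$ $\Psi$-balls; $B$ is its outer ball and $B_1,\dots,B_h$ are its holes. The bipartite graph $(X,Y;E)$ has VC-minimal complexity $<N$ if there is a directed family $\Psi$ of subsets of $Y$ such that for each $a\in X$, $E(a,Y)$ is a finite disjoint union $S_1\,\dot\cup\,\dots\,\dot\cup\, S_s$ (possibly $s=0$) of $\Psi$-Swiss cheeses, $S_k=B_k\setminus(B_{k,1}\cup\dots\cup B_{k,h_k})$, such that the total number of outer balls plus holes, $\sum_{k=1}^{s}(1+h_k)$, is $<N$. -}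

module Defs where

open import Data.Nat using (ℕ; suc; _+_; _*_; _^_; _≤_; _<_)
open import Data.Bool using (Bool; true)
open import Data.Fin using (Fin)
open import Data.Fin.Subset using (Subset; _∈_; _⊆_; _∩_; _─_; ⋃; ∣_∣; Empty)
open import Data.Vec using (tabulate)
open import Data.List using (List; map; length)
open import Data.Nat.ListAction using (sum)
import Data.List.Membership.Propositional as L
open import Data.List.Relation.Unary.All using (All)
open import Data.List.Relation.Unary.AllPairs using (AllPairs)
open import Data.Product using (Σ; _×_; ∃)
open import Data.Sum using (_⊎_)
open import Relation.Binary.PropositionalEquality using (_≡_)
import Data.Empty

-- A finite bipartite graph (X,Y;E) with |X| = m, |Y| = n:
-- X = Fin m, Y = Fin n (disjoint as distinct types), E given by its indicator.
BipGraph : ℕ → ℕ → Set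
BipGraph m n = Fin m → Fin n → Bool

nbhd : ∀ {m n} → BipGraph m n → Fin m → Subset n
nbhd E a = tabulate (λ b → E a b)

Disjoint : ∀ {n} → Subset n → Subset n → Set
Disjoint p q = Empty (p ∩ q)

Directed : ∀ {n} → List (Subset n) → Set
Directed Ψ = ∀ {B B'} → B L.∈ Ψ → B' L.∈ Ψ → (B ⊆ B') ⊎ (B' ⊆ B) ⊎ Disjoint B B'

-- A Swiss cheese presented by its outer ball and list of holes.
record Cheese (n : ℕ) : Set where
  constructor cheese
  field
    outer : Subset n
    holes : List (Subset n)
open Cheese public

cheeseSet : ∀ {n} → Cheese n → Subset n
cheeseSet c = outer c ─ ⋃ (holes c)

CheeseIn : ∀ {n} → List (Subset n) → Cheese n → Set
CheeseIn Ψ c = (outer c L.∈ Ψ) × All (λ H → H L.∈ Ψ) (holes c)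

cost : ∀ {n} → List (Cheese n) → ℕ
cost cs = sum (map (λ c → suc (length (holes c))) cs)

VCMinComplexityLT : ∀ {m n} → BipGraph m n → ℕ → Set
VCMinComplexityLT {m} {n} E N =
  Σ (List (Subset n)) λ Ψ → Directed Ψ ×
    ((a : Fin m) → Σ (List (Cheese n)) λ cs →
        All (CheeseIn Ψ) cs
      × AllPairs (λ c c' → Disjoint (cheeseSet c) (cheeseSet c')) cs
      × nbhd E a ≡ ⋃ (map cheeseSet cs)
      × cost cs < N)

Homogeneous : ∀ {m n} → BipGraph m n → Subset m → Subset n → Set
Homogeneous E X' Y' =
    (∀ {x y} → x ∈ X' → y ∈ Y' → E x y ≡ true)
  ⊎ (∀ {x y} → x ∈ X' → y ∈ Y' → ¬true (E x y))
  where
  ¬true : Bool → Set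
  ¬true b = b ≡ true → Data.Empty.⊥

{-# OPTIONS --safe #-}

-- Sort the balls of Ψ by size and, taking them in that order, stably move the points of
-- each ball to the front of an enumeration of Y.  A ball B is nested in or disjoint from
-- every ball at least as large, so the later moves keep B consecutive: in the final enumeration σ
-- every ball is an interval.  Cut σ into q ≥ 4N blocks of equal length t.  An interval
-- splits at most two blocks, and E(a,Y) is a Boolean combination of fewer than N balls,
-- so each row E(a,·) is constant on all but 2N blocks.  Double counting gives a block on
-- which at least |X|/2 rows are constant, and at least half of those take the same value
-- there.  With q = 2^(N+3) this gives |X'| ≥ |X|/4 and |Y'| ≥ t ≥ |Y|/2q.
module Submission where

open import Defs
open import Data.Nat using (ℕ; zero; suc; _+_; _*_; _∸_; _^_; _≤_; _<_; _≤?_; z≤n; s≤s)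
open import Data.Nat.Properties
open import Data.Nat.DivMod using (_/_; _%_; m/n*n≤m; m≡m%n+[m/n]*n; m%n<n; m≥n⇒m/n>0)
open import Data.Bool using (Bool; true; false; not; _∧_; _∨_)
open import Data.Bool.Properties using (not-¬; not-injective; ∨-zeroʳ; ∧-zeroʳ)
open import Data.Bool.ListAction using (any)
open import Data.Fin using (Fin; zero; suc)
open import Data.Fin.Properties using (any?)
open import Data.Fin.Subset using (Subset; ∣_∣; _⊆_; ⋃; ⁅_⁆; ⊤; ⊥) renaming (_∈_ to _∈ₛ_; _∉_ to _∉ₛ_)
open import Data.Fin.Subset.Properties
  using (_∈?_; ∣⊤∣≡n; ∣⁅x⁆∣≡1; x∈p∩q⁺; x∈p∪q⁺; x∈p∪q⁻; q⊆p∪q; ∉⊥; x∈⁅x⁆; x∈⁅y⁆⇒x≡y; p⊂q⇒∣p∣<∣q∣)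
open import Data.Vec using (tabulate; lookup; zipWith)
open import Data.Vec.Properties using (lookup⇒[]=; []=⇒lookup; lookup-zipWith; lookup-replicate; lookup∘tabulate)
open import Data.Vec.Functional using (Vector)
open import Data.List using (List; []; _∷_; _++_; length; map; filterᵇ; take; drop; allFin)
open import Data.List.Properties using (length-++; length-take; length-drop; length-tabulate; take++drop≡id)
open import Data.List.Membership.Propositional using (_∈_)
open import Data.List.Membership.Propositional.Properties using (∈-map⁺)
open import Data.List.Relation.Unary.Any using (here; there)
open import Data.List.Relation.Unary.All as All using (All; []; _∷_)
import Data.List.Relation.Unary.All.Properties as Allₚ
open import Data.List.Relation.Unary.AllPairs using (AllPairs; []; _∷_)
import Data.List.Relation.Unary.AllPairs.Properties as AllPairsₚ
open import Data.List.Relation.Unary.Linked.Properties using (Linked⇒AllPairs)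
open import Data.List.Relation.Unary.Unique.Propositional using (Unique)
import Data.List.Relation.Unary.Unique.Propositional.Properties as Uniqueₚ
open import Data.List.Relation.Binary.Permutation.Propositional using (_↭_; ↭-refl; ↭-sym; ↭-trans; prep; ↭⇒↭ₛ)
open import Data.List.Relation.Binary.Permutation.Propositional.Properties using (shift; ↭-length; ∈-resp-↭)
import Data.List.Relation.Binary.Permutation.Setoid.Properties as Permₛ
import Data.List.Sort.InsertionSort
import Data.List.Sort.InsertionSort.Properties
open import Data.Product using (Σ; Σ-syntax; _×_; _,_; proj₁; proj₂; ∃-syntax)
open import Data.Sum using (_⊎_; inj₁; inj₂)
open import Function using (_∘_; id)
open import Relation.Nullary using (yes; no; contradiction)
open import Relation.Nullary.Decidable using (T?)
open import Relation.Binary.Bundles using (DecTotalOrder)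
import Relation.Binary.Construct.On as On
open import Relation.Binary.PropositionalEquality
open import Algebra.Properties.CommutativeSemigroup +-commutativeSemigroup using (interchange)
open import Algebra.Properties.CommutativeMonoid.Sum +-0-commutativeMonoid
  using (sum; sum-syntax; sum-cong-≗; ∑-distrib-+; ∑-comm)

indicator : Bool → ℕ
indicator false = 0
indicator true  = 1

indicator≤1 : ∀ b → indicator b ≤ 1
indicator≤1 false = z≤n
indicator≤1 true  = ≤-refl

count : ∀ {k} → (Fin k → Bool) → ℕ
count {k} p = ∑[ i < k ] indicator (p i)

∑-mono-≤ : ∀ {k} {f g : Fin k → ℕ} → (∀ i → f i ≤ g i) → sum f ≤ sum g
∑-mono-≤ {zero}  f≤g = z≤n
∑-mono-≤ {suc k} f≤g = +-mono-≤ (f≤g zero) (∑-mono-≤ (f≤g ∘ suc))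

∑-const : ∀ k c → ∑[ i < k ] c ≡ k * c
∑-const zero    c = refl
∑-const (suc k) c = cong (c +_) (∑-const k c)

count-∧-split : ∀ {k} (p q : Fin k → Bool) →
  count p ≡ count (λ i → p i ∧ q i) + count (λ i → p i ∧ not (q i))
count-∧-split {k} p q = begin
  count p                                                   ≡⟨ sum-cong-≗ (λ i → split (p i) (q i)) ⟩
  ∑[ i < k ] (indicator (p i ∧ q i) + indicator (p i ∧ not (q i)))
    ≡⟨ ∑-distrib-+ (λ i → indicator (p i ∧ q i)) (λ i → indicator (p i ∧ not (q i))) ⟩
  count (λ i → p i ∧ q i) + count (λ i → p i ∧ not (q i))  ∎
  where
  open ≡-Reasoning
  split : ∀ a b → indicator a ≡ indicator (a ∧ b) + indicator (a ∧ not b)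
  split false _     = refl
  split true  true  = refl
  split true  false = refl

count-true : ∀ k → count {k} (λ _ → true) ≡ k
count-true k = trans (∑-const k 1) (*-identityʳ k)

count+count-not : ∀ {k} (p : Fin k → Bool) → count p + count (not ∘ p) ≡ k
count+count-not {k} p = trans (sym (count-∧-split (λ _ → true) p)) (count-true k)

count-∨-≤ : ∀ {k} (p q : Fin k → Bool) → count (λ i → p i ∨ q i) ≤ count p + count q
count-∨-≤ p q = ≤-trans (∑-mono-≤ (λ i → union (p i) (q i)))
  (≤-reflexive (∑-distrib-+ (indicator ∘ p) (indicator ∘ q)))
  where
  union : ∀ a b → indicator (a ∨ b) ≤ indicator a + indicator b
  union true  _ = s≤s z≤n
  union false _ = ≤-refl

count-any-≤ : ∀ {A : Set} {k c} (h : A → Fin k → Bool) (xs : List A) →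
  All (λ x → count (h x) ≤ c) xs → count (λ i → any (λ x → h x i) xs) ≤ length xs * c
count-any-≤ {k = k} h [] [] = ≤-reflexive (trans (∑-const k 0) (*-zeroʳ k))
count-any-≤ h (x ∷ xs) (hx ∷ hxs) =
  ≤-trans (count-∨-≤ (h x) _) (+-mono-≤ hx (count-any-≤ h xs hxs))

∣tabulate∣≡count : ∀ {k} (p : Fin k → Bool) → ∣ tabulate p ∣ ≡ count p
∣tabulate∣≡count {zero}  p = refl
∣tabulate∣≡count {suc k} p with p zero
... | true  = cong suc (∣tabulate∣≡count (p ∘ suc))
... | false = ∣tabulate∣≡count (p ∘ suc)

pigeonhole : ∀ {k c} (f : Fin k → ℕ) → 0 < k → k * c ≤ sum f → ∃[ i ] c ≤ f i
pigeonhole {k} {c} f 0<k k*c≤∑f with any? (λ i → c ≤? f i)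
... | yes found = found
... | no  none  = contradiction k*c≤∑f (<⇒≱ ∑f<k*c)
  where
  ∑f<k*c : sum f < k * c
  ∑f<k*c = begin-strict
    sum f                         <⟨ m<n+m (sum f) 0<k ⟩
    k + sum f                     ≡⟨ cong (_+ sum f) (*-identityʳ k) ⟨
    k * 1 + sum f                 ≡⟨ cong (_+ sum f) (∑-const k 1) ⟨
    ∑[ i < k ] 1 + sum f          ≡⟨ ∑-distrib-+ (λ _ → 1) f ⟨
    ∑[ i < k ] (1 + f i)          ≤⟨ ∑-mono-≤ (λ i → ≰⇒> (λ c≤fi → none (i , c≤fi))) ⟩
    ∑[ i < k ] c                  ≡⟨ ∑-const k c ⟩
    k * c                         ∎
    where open ≤-Reasoning

-- Convexity of a predicate along a list

module _ {A : Set} (f : A → Bool) where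

  Inside Outside : List A → Set
  Inside  = All (λ x → f x ≡ true)
  Outside = All (λ x → f x ≡ false)

  data Falling : List A → Set where
    outside : ∀ {xs} → Outside xs → Falling xs
    inside∷ : ∀ {x xs} → f x ≡ true → Falling xs → Falling (x ∷ xs)

  data Convex : List A → Set where
    falling  : ∀ {xs} → Falling xs → Convex xs
    outside∷ : ∀ {x xs} → f x ≡ false → Convex xs → Convex (x ∷ xs)

  inside++outside : ∀ {xs ys} → Inside xs → Outside ys → Falling (xs ++ ys)
  inside++outside []         o = outside o
  inside++outside (ix ∷ ixs) o = inside∷ ix (inside++outside ixs o)

  falling++outside : ∀ {xs ys} → Falling xs → Outside ys → Falling (xs ++ ys)
  falling++outside (outside oxs)  o = outside (Allₚ.++⁺ oxs o)
  falling++outside (inside∷ ix d) o = inside∷ ix (falling++outside d o)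

  convex++outside : ∀ {xs ys} → Convex xs → Outside ys → Convex (xs ++ ys)
  convex++outside (falling d)     o = falling (falling++outside d o)
  convex++outside (outside∷ ox c) o = outside∷ ox (convex++outside c o)

  outside++convex : ∀ {xs ys} → Outside xs → Convex ys → Convex (xs ++ ys)
  outside++convex []         c = c
  outside++convex (ox ∷ oxs) c = outside∷ ox (outside++convex oxs c)

  module _ (g : A → Bool) where

    filter-falling : ∀ {xs} → Falling xs → Falling (filterᵇ g xs)
    filter-falling (outside o) = outside (Allₚ.filter⁺ (T? ∘ g) o)
    filter-falling {x ∷ xs} (inside∷ ix d) with g x
    ... | true  = inside∷ ix (filter-falling d)
    ... | false = filter-falling d

    filter-convex : ∀ {xs} → Convex xs → Convex (filterᵇ g xs)
    filter-convex (falling d) = falling (filter-falling d)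
    filter-convex {x ∷ xs} (outside∷ ox c) with g x
    ... | true  = outside∷ ox (filter-convex c)
    ... | false = filter-convex c

  filter-inside : ∀ xs → Inside (filterᵇ f xs)
  filter-inside []       = []
  filter-inside (x ∷ xs) with f x in fx
  ... | true  = fx ∷ filter-inside xs
  ... | false = filter-inside xs

  filter-outside : ∀ xs → Outside (filterᵇ (not ∘ f) xs)
  filter-outside []       = []
  filter-outside (x ∷ xs) with f x in fx
  ... | true  = filter-outside xs
  ... | false = fx ∷ filter-outside xs

Nested : {A : Set} → (A → Bool) → (A → Bool) → Set
Nested j b = (∀ {x} → j x ≡ true → b x ≡ true) ⊎ (∀ {x} → j x ≡ true → b x ≡ false)

excluded⇒outside : ∀ {A : Set} {j b : A → Bool} {c} → (∀ {x} → j x ≡ true → b x ≡ c) →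
  ∀ {xs} → All (λ x → b x ≡ not c) xs → Outside j xs
excluded⇒outside {j = j} j⊆b = All.map excluded
  where
  excluded : ∀ {x} → _ ≡ not _ → j x ≡ false
  excluded {x} bx with j x in jx
  ... | false = refl
  ... | true  = contradiction bx (not-¬ (j⊆b jx))

module _ {A : Set} where

  refine : (A → Bool) → List A → List A
  refine b xs = filterᵇ b xs ++ filterᵇ (not ∘ b) xs

  refine-↭ : ∀ b xs → refine b xs ↭ xs
  refine-↭ b []       = ↭-refl
  refine-↭ b (x ∷ xs) with b x
  ... | true  = prep x (refine-↭ b xs)
  ... | false = ↭-trans (shift x (filterᵇ b xs) _) (prep x (refine-↭ b xs))

  refine-convex-self : ∀ b xs → Convex b (refine b xs)
  refine-convex-self b xs = falling (inside++outside b (filter-inside b xs) (filter-outside b xs))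

  refine-convex : ∀ {j b xs} → Nested j b → Convex j xs → Convex j (refine b xs)
  refine-convex {j} {b} {xs} (inj₁ j⊆b) c =
    convex++outside j (filter-convex j b c) (excluded⇒outside j⊆b (filter-outside b xs))
  refine-convex {j} {b} {xs} (inj₂ j⊆∁b) c =
    outside++convex j (excluded⇒outside j⊆∁b (filter-inside b xs)) (filter-convex j (not ∘ b) c)

  refineAll : List (A → Bool) → List A → List A
  refineAll []       xs = xs
  refineAll (b ∷ bs) xs = refineAll bs (refine b xs)

  refineAll-↭ : ∀ bs xs → refineAll bs xs ↭ xs
  refineAll-↭ []       xs = ↭-refl
  refineAll-↭ (b ∷ bs) xs = ↭-trans (refineAll-↭ bs (refine b xs)) (refine-↭ b xs)

  refineAll-convex : ∀ {j bs xs} → All (Nested j) bs → Convex j xs → Convex j (refineAll bs xs)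
  refineAll-convex []         c = c
  refineAll-convex (jb ∷ jbs) c = refineAll-convex jbs (refine-convex jb c)

  refineAll-convexes : ∀ {bs} xs → AllPairs Nested bs → All (λ j → Convex j (refineAll bs xs)) bs
  refineAll-convexes xs []         = []
  refineAll-convexes {b ∷ bs} xs (bbs ∷ nested) =
    refineAll-convex bbs (refine-convex-self b xs) ∷ refineAll-convexes (refine b xs) nested

-- Blocks of consecutive elements

module _ {A : Set} where

  chunks : ℕ → (q : ℕ) → List A → Vector (List A) q
  chunks t (suc q) xs zero    = take t xs
  chunks t (suc q) xs (suc i) = chunks t q (drop t xs) i

  chunk-unique : ∀ t q {xs} → Unique xs → ∀ i → Unique (chunks t q xs i)
  chunk-unique t (suc q) u zero    = Uniqueₚ.take⁺ t u
  chunk-unique t (suc q) u (suc i) = chunk-unique t q (Uniqueₚ.drop⁺ t u) i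

  chunk-length : ∀ t q xs → q * t ≤ length xs → ∀ i → length (chunks t q xs i) ≡ t
  chunk-length t (suc q) xs q*t≤∣xs∣ zero =
    trans (length-take t xs) (m≤n⇒m⊓n≡m (≤-trans (m≤m+n t (q * t)) q*t≤∣xs∣))
  chunk-length t (suc q) xs q*t≤∣xs∣ (suc i) = chunk-length t q (drop t xs) rest i
    where
    rest : q * t ≤ length (drop t xs)
    rest = begin
      q * t                ≡⟨ m+n∸m≡n t (q * t) ⟨
      t + q * t ∸ t        ≤⟨ ∸-monoˡ-≤ t q*t≤∣xs∣ ⟩
      length xs ∸ t        ≡⟨ length-drop t xs ⟨
      length (drop t xs)   ∎
      where open ≤-Reasoning

  split-at : ∀ t (P : List A → Set) {xs} → P xs → P (take t xs ++ drop t xs)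
  split-at t P = subst P (sym (take++drop≡id t _))

  nonempty : ∀ {c : List A} {t} → length c ≡ suc t → ∃[ y ] y ∈ c
  nonempty {y ∷ _} _ = y , here refl

  mixed : (A → Bool) → List A → Bool
  mixed f c = any f c ∧ any (not ∘ f) c

  any≡true⁺ : ∀ {g : A → Bool} {y c} → g y ≡ true → y ∈ c → any g c ≡ true
  any≡true⁺ gy (here refl)       rewrite gy = refl
  any≡true⁺ {g} gy (there {x} y∈c) = trans (cong (g x ∨_) (any≡true⁺ gy y∈c)) (∨-zeroʳ (g x))

  any≡false⁺ : ∀ {g : A → Bool} {c} → All (λ x → g x ≡ false) c → any g c ≡ false
  any≡false⁺ []         = refl
  any≡false⁺ (gx ∷ gxs) rewrite gx = any≡false⁺ gxs

  any≡false⁻ : ∀ {g : A → Bool} c → any g c ≡ false → All (λ x → g x ≡ false) c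
  any≡false⁻         []      _    = []
  any≡false⁻ {g} (x ∷ c) none with g x in gx
  ... | false = gx ∷ any≡false⁻ c none

  module _ (f : A → Bool) where

    outside⇒unmixed : ∀ {c} → Outside f c → mixed f c ≡ false
    outside⇒unmixed o rewrite any≡false⁺ o = refl

    inside⇒unmixed : ∀ {c} → Inside f c → mixed f c ≡ false
    inside⇒unmixed {c} i rewrite any≡false⁺ (All.map (cong not) i) = ∧-zeroʳ (any f c)

    unmixed⇒constant : ∀ {c y y'} → mixed f c ≡ false → y ∈ c → y' ∈ c → f y ≡ f y'
    unmixed⇒constant {y = y} {y'} unmixed y∈c y'∈c with f y in fy | f y' in fy'
    ... | true  | true  = refl
    ... | false | false = refl
    ... | true  | false =
      contradiction (trans (sym (cong₂ _∧_ (any≡true⁺ fy y∈c) (any≡true⁺ (cong not fy') y'∈c))) unmixed) λ ()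
    ... | false | true  =
      contradiction (trans (sym (cong₂ _∧_ (any≡true⁺ fy' y'∈c) (any≡true⁺ (cong not fy) y∈c))) unmixed) λ ()

    falling-++⁻ : ∀ c {s} → Falling f (c ++ s) → (Inside f c × Falling f s) ⊎ Outside f s
    falling-++⁻ []      d                 = inj₁ ([] , d)
    falling-++⁻ (_ ∷ c) (outside (_ ∷ o)) = inj₂ (Allₚ.++⁻ʳ c o)
    falling-++⁻ (_ ∷ c) (inside∷ ix d) with falling-++⁻ c d
    ... | inj₁ (i , d') = inj₁ (ix ∷ i , d')
    ... | inj₂ o        = inj₂ o

    convex-++⁻ : ∀ c {s} → Convex f (c ++ s) → (Outside f c × Convex f s) ⊎ Falling f s
    convex-++⁻ []      cv               = inj₁ ([] , cv)
    convex-++⁻ c       (falling d) with falling-++⁻ c d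
    ... | inj₁ (_ , d') = inj₂ d'
    ... | inj₂ o        = inj₂ (outside o)
    convex-++⁻ (_ ∷ c) (outside∷ ox cv) with convex-++⁻ c cv
    ... | inj₁ (o , cv') = inj₁ (ox ∷ o , cv')
    ... | inj₂ d         = inj₂ d

    mixedChunks : ℕ → (q : ℕ) → List A → ℕ
    mixedChunks t q xs = count (λ i → mixed f (chunks t q xs i))

    outside-mixedChunks : ∀ t q {xs} → Outside f xs → mixedChunks t q xs ≡ 0
    outside-mixedChunks t zero    o = refl
    outside-mixedChunks t (suc q) o
      rewrite outside⇒unmixed (Allₚ.take⁺ t o) = outside-mixedChunks t q (Allₚ.drop⁺ t o)

    falling-mixedChunks : ∀ t q {xs} → Falling f xs → mixedChunks t q xs ≤ 1
    falling-mixedChunks t zero    d = z≤n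
    falling-mixedChunks t (suc q) {xs} d with falling-++⁻ (take t xs) (split-at t (Falling f) d)
    ... | inj₁ (i , d') rewrite inside⇒unmixed i = falling-mixedChunks t q d'
    ... | inj₂ o rewrite outside-mixedChunks t q o | +-identityʳ (indicator (mixed f (take t xs))) =
      indicator≤1 (mixed f (take t xs))

    convex-mixedChunks : ∀ t q {xs} → Convex f xs → mixedChunks t q xs ≤ 2
    convex-mixedChunks t zero    cv = z≤n
    convex-mixedChunks t (suc q) {xs} cv with convex-++⁻ (take t xs) (split-at t (Convex f) cv)
    ... | inj₁ (o , cv') rewrite outside⇒unmixed o = convex-mixedChunks t q cv'
    ... | inj₂ d = +-mono-≤ (indicator≤1 (mixed f (take t xs))) (falling-mixedChunks t q d)

-- An enumeration in which every ball is an interval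

allPairs-within : ∀ {A : Set} {P : A → Set} {R S : A → A → Set} →
  (∀ {x y} → P x → P y → R x y → S x y) → ∀ {xs} → All P xs → AllPairs R xs → AllPairs S xs
allPairs-within within []         []         = []
allPairs-within within (px ∷ pxs) (rx ∷ rxs) =
  All.zipWith (λ (py , rxy) → within px py rxy) (pxs , rx) ∷ allPairs-within within pxs rxs

module _ {n : ℕ} where

  ⊆⇒lookup : ∀ {J B : Subset n} → J ⊆ B → ∀ {y} → lookup J y ≡ true → lookup B y ≡ true
  ⊆⇒lookup J⊆B {y} Jy = []=⇒lookup (J⊆B (lookup⇒[]= y _ Jy))

  disjoint⇒lookup : ∀ {J B : Subset n} → Disjoint J B → ∀ {y} → lookup J y ≡ true → lookup B y ≡ false
  disjoint⇒lookup {J} {B} J∩B≡∅ {y} Jy with lookup B y in By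
  ... | false = refl
  ... | true  = contradiction (y , x∈p∩q⁺ (lookup⇒[]= y J Jy , lookup⇒[]= y B By)) J∩B≡∅

  ⊆-∣∣-antisym : ∀ {J B : Subset n} → B ⊆ J → ∣ J ∣ ≤ ∣ B ∣ → J ⊆ B
  ⊆-∣∣-antisym {J} {B} B⊆J ∣J∣≤∣B∣ {y} y∈J with y ∈? B
  ... | yes y∈B = y∈B
  ... | no  y∉B = contradiction ∣J∣≤∣B∣ (<⇒≱ (p⊂q⇒∣p∣<∣q∣ (B⊆J , y , y∈J , y∉B)))

  directed⇒nested : ∀ {Ψ J B} → Directed Ψ → J ∈ Ψ → B ∈ Ψ → ∣ J ∣ ≤ ∣ B ∣ →
    Nested (lookup J) (lookup B)
  directed⇒nested dir J∈Ψ B∈Ψ ∣J∣≤∣B∣ with dir J∈Ψ B∈Ψ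
  ... | inj₁ J⊆B         = inj₁ (⊆⇒lookup J⊆B)
  ... | inj₂ (inj₁ B⊆J)  = inj₁ (⊆⇒lookup (⊆-∣∣-antisym B⊆J ∣J∣≤∣B∣))
  ... | inj₂ (inj₂ J∩B≡∅) = inj₂ (disjoint⇒lookup J∩B≡∅)

  private
    bySize : DecTotalOrder _ _ _
    bySize = On.decTotalOrder ≤-decTotalOrder (∣_∣ {n})

  open Data.List.Sort.InsertionSort bySize using (sort)
  open Data.List.Sort.InsertionSort.Properties bySize using (sort-↭; sort-↗)

  -- Sorting by size puts every ball before the larger balls, which by directedness
  -- contain it or are disjoint from it.
  ballOrder : List (Subset n) → List (Fin n)
  ballOrder Ψ = refineAll (map lookup (sort Ψ)) (allFin n)

  ballOrder-↭ : ∀ Ψ → ballOrder Ψ ↭ allFin n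
  ballOrder-↭ Ψ = refineAll-↭ (map lookup (sort Ψ)) (allFin n)

  ballOrder-unique : ∀ Ψ → Unique (ballOrder Ψ)
  ballOrder-unique Ψ =
    Permₛ.Unique-resp-↭ (setoid (Fin n)) (↭⇒↭ₛ (↭-sym (ballOrder-↭ Ψ))) (Uniqueₚ.allFin⁺ n)

  ballOrder-length : ∀ Ψ → length (ballOrder Ψ) ≡ n
  ballOrder-length Ψ = trans (↭-length (ballOrder-↭ Ψ)) (length-tabulate id)

  ballOrder-convex : ∀ {Ψ B} → Directed Ψ → B ∈ Ψ → Convex (lookup B) (ballOrder Ψ)
  ballOrder-convex {Ψ} {B} dir B∈Ψ =
    All.lookup (refineAll-convexes (allFin n) (AllPairsₚ.map⁺ sortedNested)) (∈-map⁺ lookup B∈sort)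
    where
    sorted∈Ψ : All (_∈ Ψ) (sort Ψ)
    sorted∈Ψ = All.tabulate (∈-resp-↭ (sort-↭ Ψ))

    sortedNested : AllPairs (λ J B → Nested (lookup J) (lookup B)) (sort Ψ)
    sortedNested = allPairs-within (directed⇒nested dir) sorted∈Ψ (Linked⇒AllPairs ≤-trans (sort-↗ Ψ))

    B∈sort : B ∈ sort Ψ
    B∈sort = ∈-resp-↭ (↭-sym (sort-↭ Ψ)) B∈Ψ

module _ {n : ℕ} where

  balls : List (Cheese n) → List (Subset n)
  balls []       = []
  balls (c ∷ cs) = outer c ∷ holes c ++ balls cs

  length-balls : ∀ cs → length (balls cs) ≡ cost cs
  length-balls []       = refl
  length-balls (c ∷ cs) = cong suc (trans (length-++ (holes c)) (cong (length (holes c) +_) (length-balls cs)))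

  balls-∈ : ∀ {Ψ cs} → All (CheeseIn Ψ) cs → All (_∈ Ψ) (balls cs)
  balls-∈ []                   = []
  balls-∈ ((o∈Ψ , hs∈Ψ) ∷ cs∈Ψ) = o∈Ψ ∷ Allₚ.++⁺ hs∈Ψ (balls-∈ cs∈Ψ)

  Agrees : Fin n → Fin n → Subset n → Set
  Agrees y y' p = lookup p y ≡ lookup p y'

  zipWith-agrees : ∀ (_•_ : Bool → Bool → Bool) p q {y y'} → Agrees y y' p → Agrees y y' q →
    Agrees y y' (zipWith _•_ p q)
  zipWith-agrees _•_ p q {y} {y'} py qy = begin
    lookup (zipWith _•_ p q) y   ≡⟨ lookup-zipWith _•_ y p q ⟩
    lookup p y • lookup q y      ≡⟨ cong₂ _•_ py qy ⟩
    lookup p y' • lookup q y'    ≡⟨ lookup-zipWith _•_ y' p q ⟨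
    lookup (zipWith _•_ p q) y'  ∎
    where open ≡-Reasoning

  ⋃-agrees : ∀ {y y' ps} → All (Agrees y y') ps → Agrees y y' (⋃ ps)
  ⋃-agrees {y} {y'} []               = trans (lookup-replicate y false) (sym (lookup-replicate y' false))
  ⋃-agrees {ps = p ∷ ps} (py ∷ psy) = zipWith-agrees _∨_ p (⋃ ps) py (⋃-agrees psy)

  cheeses-agree : ∀ {y y'} cs → All (Agrees y y') (balls cs) → Agrees y y' (⋃ (map cheeseSet cs))
  cheeses-agree []       _ = ⋃-agrees {ps = []} []
  cheeses-agree (c ∷ cs) (o ∷ rest) with Allₚ.++⁻ (holes c) rest
  ... | hs , rest' = zipWith-agrees _∨_ (cheeseSet c) (⋃ (map cheeseSet cs))
    (zipWith-agrees _ (outer c) (⋃ (holes c)) o (⋃-agrees hs)) (cheeses-agree cs rest')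

  ∈-⋃⁅⁆⁻ : ∀ (c : List (Fin n)) {y} → y ∈ₛ ⋃ (map ⁅_⁆ c) → y ∈ c
  ∈-⋃⁅⁆⁻ []      y∈ = contradiction y∈ ∉⊥
  ∈-⋃⁅⁆⁻ (x ∷ c) y∈ with x∈p∪q⁻ ⁅ x ⁆ (⋃ (map ⁅_⁆ c)) y∈
  ... | inj₁ y∈⁅x⁆  = here (x∈⁅y⁆⇒x≡y x y∈⁅x⁆)
  ... | inj₂ y∈rest = there (∈-⋃⁅⁆⁻ c y∈rest)

  length≤∣⋃⁅⁆∣ : ∀ (c : List (Fin n)) → Unique c → length c ≤ ∣ ⋃ (map ⁅_⁆ c) ∣
  length≤∣⋃⁅⁆∣ []      _           = z≤n
  length≤∣⋃⁅⁆∣ (x ∷ c) (x∉c ∷ u) =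
    ≤-trans (s≤s (length≤∣⋃⁅⁆∣ c u)) (p⊂q⇒∣p∣<∣q∣ (q⊆p∪q ⁅ x ⁆ _ , x , x∈p∪q⁺ (inj₁ (x∈⁅x⁆ x)) , x∉rest))
    where
    x∉rest : x ∉ₛ ⋃ (map ⁅_⁆ c)
    x∉rest x∈rest = All.lookup x∉c (∈-⋃⁅⁆⁻ c x∈rest) refl

∈tabulate⇒ : ∀ {m} {p : Fin m → Bool} {a} → a ∈ₛ tabulate p → p a ≡ true
∈tabulate⇒ {p = p} {a} a∈ = trans (sym (lookup∘tabulate p a)) ([]=⇒lookup a∈)

∧-true⁻ : ∀ {a b} → a ∧ b ≡ true → a ≡ true × b ≡ true
∧-true⁻ {true} {true} _ = refl , refl

larger-part : ∀ {m b c} (p : Fin m → Bool) → c ≡ count p + b → b ≤ count p → c ≤ 2 * ∣ tabulate p ∣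
larger-part p refl b≤p rewrite ∣tabulate∣≡count p =
  ≤-trans (+-monoʳ-≤ (count p) b≤p) (≤-reflexive (cong (count p +_) (sym (+-identityʳ (count p)))))

majority : ∀ {m} (g h : Fin m → Bool) →
  ∃[ v ] Σ[ X' ∈ Subset m ] count g ≤ 2 * ∣ X' ∣ × (∀ {a} → a ∈ₛ X' → g a ≡ true × h a ≡ v)
majority g h with ≤-total (count (λ a → g a ∧ not (h a))) (count (λ a → g a ∧ h a))
... | inj₁ ∣no∣≤∣yes∣ =
  true , tabulate (λ a → g a ∧ h a) , larger-part (λ a → g a ∧ h a) (count-∧-split g h) ∣no∣≤∣yes∣ ,
  ∧-true⁻ ∘ ∈tabulate⇒
... | inj₂ ∣yes∣≤∣no∣ =
  false , tabulate (λ a → g a ∧ not (h a)) , larger-part (λ a → g a ∧ not (h a))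
    (trans (count-∧-split g h) (+-comm (count (λ a → g a ∧ h a)) _)) ∣yes∣≤∣no∣ ,
  λ a∈ → let ga , ¬ha = ∧-true⁻ (∈tabulate⇒ a∈) in ga , not-injective ¬ha

constant⇒homogeneous : ∀ {m n} (E : BipGraph m n) {X' Y'} v →
  (∀ {x y} → x ∈ₛ X' → y ∈ₛ Y' → E x y ≡ v) → Homogeneous E X' Y'
constant⇒homogeneous E true  E≡v = inj₁ E≡v
constant⇒homogeneous E false E≡v = inj₂ λ x∈ y∈ Exy → contradiction (trans (sym (E≡v x∈ y∈)) Exy) λ ()

column-homogeneous : ∀ {m n} (E : BipGraph m n) (y₀ : Fin n) →
  Σ[ X' ∈ Subset m ] m ≤ 2 * ∣ X' ∣ × Homogeneous E X' ⁅ y₀ ⁆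
column-homogeneous {m} E y₀ with majority (λ _ → true) (λ a → E a y₀)
... | v , X' , m≤2∣X'∣ , members =
  X' , subst (_≤ 2 * ∣ X' ∣) (count-true m) m≤2∣X'∣ ,
  constant⇒homogeneous E v λ x∈ y∈ → subst (λ y → E _ y ≡ v) (sym (x∈⁅y⁆⇒x≡y y₀ y∈)) (proj₂ (members x∈))

divide : ∀ n q → 0 < q → q ≤ n → ∃[ t ] q * suc t ≤ n × n ≤ 2 * q * suc t
divide n q@(suc _) _ q≤n
  with n / q | m/n*n≤m n q | m≡m%n+[m/n]*n n q | m%n<n n q | m≥n⇒m/n>0 {n} {q} q≤n
... | suc t | s*q≤n | n≡r+s*q | r<q | _ = t , subst (_≤ n) (*-comm (suc t) q) s*q≤n , (begin
  n                             ≡⟨ n≡r+s*q ⟩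
  n % q + suc t * q             ≤⟨ +-monoˡ-≤ (suc t * q) (<⇒≤ r<q) ⟩
  q + suc t * q                 ≤⟨ +-monoˡ-≤ (suc t * q) (m≤m+n q (t * q)) ⟩
  suc t * q + suc t * q         ≡⟨ cong (suc t * q +_) (+-identityʳ (suc t * q)) ⟨
  2 * (suc t * q)               ≡⟨ cong (2 *_) (*-comm (suc t) q) ⟩
  2 * (q * suc t)               ≡⟨ *-assoc 2 q (suc t) ⟨
  2 * q * suc t                 ∎)
  where open ≤-Reasoning

halve : ∀ {a b c} → a ≤ b + c → c + c ≤ a → a ≤ b + b
halve {a} {b} {c} a≤b+c c+c≤a = +-cancelʳ-≤ a a (b + b) (begin
  a + a                ≤⟨ +-mono-≤ a≤b+c a≤b+c ⟩
  (b + c) + (b + c)    ≡⟨ interchange b c b c ⟩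
  (b + b) + (c + c)    ≤⟨ +-monoʳ-≤ (b + b) c+c≤a ⟩
  (b + b) + a          ∎)
  where open ≤-Reasoning

module Blocks {N m n : ℕ} (E : BipGraph m n) (vc : VCMinComplexityLT E N) where

  Ψ : List (Subset n)
  Ψ = proj₁ vc

  directed : Directed Ψ
  directed = proj₁ (proj₂ vc)

  presentation : Fin m → List (Cheese n)
  presentation a = proj₁ (proj₂ (proj₂ vc) a)

  rowBalls : Fin m → List (Subset n)
  rowBalls a = balls (presentation a)

  rowBalls-∈ : ∀ a → All (_∈ Ψ) (rowBalls a)
  rowBalls-∈ a = balls-∈ (proj₁ (proj₂ (proj₂ (proj₂ vc) a)))

  row≡cheeses : ∀ a → nbhd E a ≡ ⋃ (map cheeseSet (presentation a))
  row≡cheeses a = proj₁ (proj₂ (proj₂ (proj₂ (proj₂ (proj₂ vc) a))))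

  length-rowBalls : ∀ a → length (rowBalls a) < N
  length-rowBalls a =
    subst (_< N) (sym (length-balls (presentation a))) (proj₂ (proj₂ (proj₂ (proj₂ (proj₂ (proj₂ vc) a)))))

  block : ℕ → (q : ℕ) → Vector (List (Fin n)) q
  block t q = chunks t q (ballOrder Ψ)

  block-length : ∀ t q i → q * t ≤ n → length (block t q i) ≡ t
  block-length t q i q*t≤n =
    chunk-length t q (ballOrder Ψ) (subst (q * t ≤_) (sym (ballOrder-length Ψ)) q*t≤n) i

  block-unique : ∀ t q i → Unique (block t q i)
  block-unique t q = chunk-unique t q (ballOrder-unique Ψ)

  unsettled : Fin m → List (Fin n) → Bool
  unsettled a c = any (λ B → mixed (lookup B) c) (rowBalls a)

  settled⇒constant : ∀ {a c y y'} → unsettled a c ≡ false → y ∈ c → y' ∈ c → E a y ≡ E a y'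
  settled⇒constant {a} {c} {y} {y'} settled y∈c y'∈c = begin
    E a y                                           ≡⟨ lookup∘tabulate (E a) y ⟨
    lookup (nbhd E a) y                             ≡⟨ cong (λ p → lookup p y) (row≡cheeses a) ⟩
    lookup (⋃ (map cheeseSet (presentation a))) y   ≡⟨ cheeses-agree (presentation a) ballsAgree ⟩
    lookup (⋃ (map cheeseSet (presentation a))) y'  ≡⟨ cong (λ p → lookup p y') (row≡cheeses a) ⟨
    lookup (nbhd E a) y'                            ≡⟨ lookup∘tabulate (E a) y' ⟩
    E a y'                                          ∎
    where
    open ≡-Reasoning
    ballsAgree : All (Agrees y y') (rowBalls a)
    ballsAgree = All.map (λ {B} unmixed → unmixed⇒constant (lookup B) unmixed y∈c y'∈c)
                         (any≡false⁻ (rowBalls a) settled)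

  unsettled-blocks : ∀ t q a → count (λ i → unsettled a (block t q i)) ≤ N * 2
  unsettled-blocks t q a = ≤-trans
    (count-any-≤ (λ B i → mixed (lookup B) (block t q i)) (rowBalls a)
      (All.map (λ B∈Ψ → convex-mixedChunks _ t q (ballOrder-convex directed B∈Ψ)) (rowBalls-∈ a)))
    (*-monoˡ-≤ 2 (<⇒≤ (length-rowBalls a)))

  settledRows : ℕ → (q : ℕ) → Fin q → ℕ
  settledRows t q i = count (λ a → not (unsettled a (block t q i)))

  rich-block : ∀ t q → 0 < q → N * 4 ≤ q → ∃[ i ] m ≤ 2 * settledRows t q i
  rich-block t q 0<q N*4≤q with pigeonhole (λ i → settledRows t q i + settledRows t q i) 0<q q*m≤2∑
    where
    settledBlocks : Fin m → ℕ
    settledBlocks a = count (λ i → not (unsettled a (block t q i)))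

    settled-blocks : ∀ a → q ≤ settledBlocks a + N * 2
    settled-blocks a = begin
      q                                                          ≡⟨ count+count-not (λ i → unsettled a (block t q i)) ⟨
      count (λ i → unsettled a (block t q i)) + settledBlocks a  ≤⟨ +-monoˡ-≤ _ (unsettled-blocks t q a) ⟩
      N * 2 + settledBlocks a                                    ≡⟨ +-comm (N * 2) _ ⟩
      settledBlocks a + N * 2                                    ∎
      where open ≤-Reasoning

    ∑settled : ℕ
    ∑settled = ∑[ i < q ] settledRows t q i

    m*q≤ : m * q ≤ ∑settled + m * (N * 2)
    m*q≤ = begin
      m * q                                            ≡⟨ ∑-const m q ⟨
      ∑[ a < m ] q                                     ≤⟨ ∑-mono-≤ settled-blocks ⟩
      ∑[ a < m ] (settledBlocks a + N * 2)             ≡⟨ ∑-distrib-+ settledBlocks (λ _ → N * 2) ⟩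
      ∑[ a < m ] settledBlocks a + ∑[ a < m ] (N * 2)
        ≡⟨ cong₂ _+_ (∑-comm (λ a i → indicator (not (unsettled a (block t q i))))) (∑-const m (N * 2)) ⟩
      ∑settled + m * (N * 2)                           ∎
      where open ≤-Reasoning

    m*2N≤ : m * (N * 2) + m * (N * 2) ≤ m * q
    m*2N≤ = begin
      m * (N * 2) + m * (N * 2)   ≡⟨ *-distribˡ-+ m (N * 2) (N * 2) ⟨
      m * (N * 2 + N * 2)         ≡⟨ cong (m *_) (*-distribˡ-+ N 2 2) ⟨
      m * (N * 4)                 ≤⟨ *-monoʳ-≤ m N*4≤q ⟩
      m * q                       ∎
      where open ≤-Reasoning

    q*m≤2∑ : q * m ≤ ∑[ i < q ] (settledRows t q i + settledRows t q i)
    q*m≤2∑ = begin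
      q * m                                               ≡⟨ *-comm q m ⟩
      m * q                                               ≤⟨ halve {b = ∑settled} {c = m * (N * 2)} m*q≤ m*2N≤ ⟩
      ∑settled + ∑settled                                 ≡⟨ ∑-distrib-+ (settledRows t q) (settledRows t q) ⟨
      ∑[ i < q ] (settledRows t q i + settledRows t q i)  ∎
      where open ≤-Reasoning
  ... | i , m≤S+S = i , ≤-trans m≤S+S (≤-reflexive (cong (settledRows t q i +_) (sym (+-identityʳ _))))

  homogeneous-block : ∀ t q (i : Fin q) → q * suc t ≤ n →
    Σ[ X' ∈ Subset m ] Σ[ Y' ∈ Subset n ]
      settledRows (suc t) q i ≤ 2 * ∣ X' ∣ × suc t ≤ ∣ Y' ∣ × Homogeneous E X' Y'
  homogeneous-block t q i q*t≤n
    with y₀ , y₀∈c ← nonempty (block-length (suc t) q i q*t≤n)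
    with v , X' , S≤2∣X'∣ , members ← majority (λ a → not (unsettled a (block (suc t) q i))) (λ a → E a y₀)
    = X' , ⋃ (map ⁅_⁆ c) , S≤2∣X'∣ ,
      subst (_≤ ∣ ⋃ (map ⁅_⁆ c) ∣) (block-length (suc t) q i q*t≤n) (length≤∣⋃⁅⁆∣ c (block-unique (suc t) q i)) ,
      constant⇒homogeneous E v λ x∈ y∈ →
        trans (settled⇒constant {c = c} (not-injective (proj₁ (members x∈))) (∈-⋃⁅⁆⁻ c y∈) y₀∈c)
              (proj₂ (members x∈))
    where
    c : List (Fin n)
    c = block (suc t) q i

homogeneous-pair : ∀ {N m n} (E : BipGraph m n) → VCMinComplexityLT E N → ∀ q → 0 < q → N * 4 ≤ q →
  Σ[ X' ∈ Subset m ] Σ[ Y' ∈ Subset n ] m ≤ 4 * ∣ X' ∣ × n ≤ 2 * q * ∣ Y' ∣ × Homogeneous E X' Y'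
homogeneous-pair {m = m} {zero} E vc q _ _ =
  ⊤ , ⊥ , subst (λ k → m ≤ 4 * k) (sym (∣⊤∣≡n m)) (m≤n*m m 4) , z≤n , inj₁ λ { {y = ()} }
homogeneous-pair {m = m} {suc n} E vc q 0<q N*4≤q with q ≤? suc n
... | no q≰n with X' , m≤2∣X'∣ , hom ← column-homogeneous E zero =
  X' , ⁅ zero ⁆ , ≤-trans m≤2∣X'∣ (*-monoˡ-≤ ∣ X' ∣ {2} {4} (s≤s (s≤s z≤n))) , ≤2q*∣⁅0⁆∣ (<⇒≤ (≰⇒> q≰n)) , hom
  where
  ≤2q*∣⁅0⁆∣ : ∀ {k} → k ≤ q → k ≤ 2 * q * ∣ ⁅ zero {n} ⁆ ∣
  ≤2q*∣⁅0⁆∣ {k} k≤q = begin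
    k                       ≤⟨ k≤q ⟩
    q                       ≤⟨ m≤m+n q (q + 0) ⟩
    2 * q                   ≡⟨ *-identityʳ (2 * q) ⟨
    2 * q * 1               ≡⟨ cong (2 * q *_) (∣⁅x⁆∣≡1 {suc n} zero) ⟨
    2 * q * ∣ ⁅ zero {n} ⁆ ∣  ∎
    where open ≤-Reasoning
... | yes q≤n
  with t , q*t≤n , n≤2qt ← divide (suc n) q 0<q q≤n
  with i , m≤2S ← Blocks.rich-block E vc (suc t) q 0<q N*4≤q
  with X' , Y' , S≤2∣X'∣ , t≤∣Y'∣ , hom ← Blocks.homogeneous-block E vc t q i q*t≤n =
  X' , Y' , ≤-trans m≤2S (≤-trans (*-monoʳ-≤ 2 S≤2∣X'∣) (≤-reflexive (sym (*-assoc 2 2 ∣ X' ∣)))) ,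
  ≤-trans n≤2qt (*-monoʳ-≤ (2 * q) t≤∣Y'∣) , hom

n≤2^n : ∀ n → n ≤ 2 ^ n
n≤2^n zero    = z≤n
n≤2^n (suc n) = +-mono-≤ (m^n>0 2 n) (≤-trans (n≤2^n n) (≤-reflexive (sym (+-identityʳ (2 ^ n)))))

N*4≤2^[N+3] : ∀ N → N * 4 ≤ 2 ^ (N + 3)
N*4≤2^[N+3] N = ≤-trans (*-mono-≤ (n≤2^n N) (m≤m+n 4 4)) (≤-reflexive (sym (^-distribˡ-+-* 2 N 3)))

theorem3p1 : (N : ℕ) → 0 < N → {m n : ℕ} → (E : BipGraph m n) →
    VCMinComplexityLT E N →
    Σ (Subset m) λ X' → Σ (Subset n) λ Y' →
    (m ≤ 2 ^ (N + 4) * ∣ X' ∣) × (n ≤ 2 ^ (N + 4) * ∣ Y' ∣) × Homogeneous E X' Y'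
theorem3p1 N _ E vc
  with X' , Y' , m≤4∣X'∣ , n≤2q∣Y'∣ , hom ← homogeneous-pair E vc (2 ^ (N + 3)) (m^n>0 2 (N + 3)) (N*4≤2^[N+3] N)
  rewrite +-suc N 3 =
  X' , Y' , ≤-trans m≤4∣X'∣ (*-monoˡ-≤ ∣ X' ∣ 4≤2^[N+4]) , n≤2q∣Y'∣ , hom
  where
  4≤2^[N+4] : 4 ≤ 2 ^ suc (N + 3)
  4≤2^[N+4] = ^-monoʳ-≤ 2 {2} (s≤s (≤-trans (s≤s z≤n) (m≤n+m 3 N)))
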